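{- Let $x,k,l,m$ be positive integers such that $\frac{k}{lm^x}>1$ and $\gcd(k,lm^x)=1$. Suppose there is a positive integer $n=\prod_{i=1}^{s}p_i^{k_i}$ ($p_i$ distinct primes, $k_i\ge1$) such that $n^x$ divides $lm^x$ and (1) $\frac{k}{lm^x}<I(x,p_i n)$ for all $1\le i\le s$, and (2) the integer $\sigma_x(n)\,l\left(\frac{m}{n}\right)^x=\sigma_x(n)\,\frac{lm^x}{n^x}$ has a divisor of the form $d^x$ ($d$ a positive integer) with $\gcd(d^x,k)=1$ and $I(x,d)\ge \frac{\sigma_x(p_j^{k_j+1})}{\sigma_x(p_j^{k_j+1})-1}$ for some $1\le j\le s$. Then $\frac{k}{lm^x}$ is an $x^{\text{th}}$ abundancy outlaw.
   Context: For positive integers $x,n$, $\sigma_x(n)=\sum_{d\mid n} d^x$ and $I(x,n)=\sigma_x(n)/n^x$. A rational number greater than one is an $x^{\text{th}}$ abundancy outlaw if it is not equal to $I(x,n)$ for any positive integer $n$. -}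

module Defs where

open import Data.Nat using (ℕ; zero; suc; _*_; _^_)
open import Data.Nat.Divisibility using (_∣_; _∣?_)
open import Data.List using (List; filter; map; upTo)
open import Data.Nat.ListAction using (sum)
open import Data.Fin using (Fin)
import Data.Fin as Fin
open import Data.Integer using (+_)
open import Data.Rational using (ℚ; _/_; 0ℚ; 1ℚ; _<_)
open import Data.Product using (Σ)
open import Relation.Binary.PropositionalEquality using (_≡_)
open import Relation.Nullary using (¬_)

divisorsOf : ℕ → List ℕ
divisorsOf n = filter (λ d → d ∣? n) (map suc (upTo n))

σ : ℕ → ℕ → ℕ
σ x n = sum (map (λ d → d ^ x) (divisorsOf n))

-- the rational a / b, for b ≥ 1 (convention: a / 0 := 0, never used)
frac : ℕ → ℕ → ℚ
frac a zero    = 0ℚ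
frac a (suc b) = (+ a) / suc b

I : ℕ → ℕ → ℚ
I x n = frac (σ x n) (n ^ x)

Outlaw : ℕ → ℚ → Set
Outlaw x q = (1ℚ < q) × ((n : ℕ) → 1 Data.Nat.≤ n → ¬ (I x n ≡ q))
  where open Data.Product using (_×_)

∏ : (s : ℕ) → (Fin s → ℕ) → ℕ
∏ zero    f = 1
∏ (suc s) f = f Fin.zero * ∏ s (λ i → f (Fin.suc i))

module Submission where

-- Let q = k/L with L = l·m^x, n = ∏ p_i^(e_i), and suppose I(x,N) = q for some
-- N ≥ 1, i.e. σ_x(N)·L = k·N^x.  Since gcd(k,L) = 1, L ∣ N^x, so n^x ∣ N^x and
-- n ∣ N; write N = n·t.  No p_i divides t, for otherwise p_i·n ∣ N and
-- monotonicity of the abundancy index along divisibility would give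
-- I(x,p_i·n) ≤ I(x,N) = q, against (1).  Hence n ⊥ t and, σ_x being
-- multiplicative, I(x,n)·I(x,t) = q.  Cancelling n^x shows σ_x(n)·(L/n^x)·σ_x(t)
-- = k·t^x, so by (2) d^x ∣ t^x, d ∣ t and I(x,d) ≤ I(x,t).  Finally, with
-- S = σ_x(p_j^(e_j+1)), one has I(x,p_j·n) = I(x,n)·S/(S−1), whence
--   q < I(x,p_j·n) = I(x,n)·S/(S−1) ≤ I(x,n)·I(x,d) ≤ I(x,n)·I(x,t) = q.

open import Defs
open import Data.Nat using (ℕ; zero; suc; _*_; _^_; _∸_; _≤_; _<_; _+_; s≤s; z≤n; _≟_;
  NonZero; >-nonZero; >-nonZero⁻¹; ≢-nonZero; nonTrivial⇒n>1)
open import Data.Nat.Properties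
open import Data.Nat.Divisibility
open import Data.Nat.DivMod using (_/_; m/n*n≡m)
open import Data.Nat.GCD using (gcd; gcd[m,n]∣m; gcd[m,n]∣n; gcd[m,n]≡0⇒n≡0)
open import Data.Nat.Coprimality
  using (Coprime; coprime-divisor; 1-coprimeTo; coprime-/gcd; gcd≡1⇒coprime)
import Data.Nat.Coprimality as Coprime
open import Data.Nat.Primality using (Prime; prime⇒irreducible; prime⇒nonTrivial)
open import Data.Nat.Tactic.RingSolver using (solve-∀)
open import Data.Nat.ListAction using (sum)
open import Data.Nat.ListAction.Properties using (sum-++; sum-↭)
open import Data.List using (List; []; _∷_; map; filter; _++_; upTo; cartesianProductWith)
open import Data.List.Properties using (map-++)
open import Data.List.Membership.Propositional using (_∈_; _∉_)
open import Data.List.Membership.Propositional.Properties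
  using (∈-filter⁻; ∈-filter⁺; ∈-map⁺; ∈-map⁻; ∈-upTo⁺; ∈-++⁺ˡ; ∈-++⁺ʳ; ∈-++⁻;
         ∈-cartesianProductWith⁺; ∈-cartesianProductWith⁻)
open import Data.List.Membership.Propositional.Properties.WithK using (unique∧set⇒bag)
open import Data.List.Membership.DecPropositional _≟_ using (_∈?_)
open import Data.List.Relation.Binary.BagAndSetEquality using (∼bag⇒↭)
import Data.List.Relation.Binary.Permutation.Propositional.Properties as Perm
open import Data.List.Relation.Unary.All as All using (All)
open import Data.List.Relation.Unary.Any using (here; there)
open import Data.List.Relation.Unary.Unique.Propositional using (Unique; []; _∷_)
import Data.List.Relation.Unary.Unique.Propositional.Properties as Unique
open import Data.Fin using (Fin)
import Data.Fin as Fin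
import Data.Fin.Properties as Fin
import Data.Rational as ℚ
import Data.Rational.Properties as ℚ
import Data.Rational.Unnormalised as ℚᵘ
import Data.Rational.Unnormalised.Properties as ℚᵘ
import Data.Integer as ℤ
import Data.Integer.Properties as ℤ
open import Data.Empty using (⊥; ⊥-elim)
open import Data.Product using (Σ; _×_; _,_; ∃; ∃₂; proj₁; proj₂)
open import Data.Sum using (inj₁; inj₂; [_,_]′)
open import Function.Base using (_∘_)
open import Function.Bundles using (mk⇔)
open import Relation.Nullary using (¬_; ¬?; Dec; yes; no)
open import Relation.Binary.PropositionalEquality

frac≃ : ∀ a b → ℚ.toℚᵘ (frac a (suc b)) ℚᵘ.≃ ℚᵘ.mkℚᵘ (ℤ.+ a) b
frac≃ a b = ℚ.toℚᵘ-fromℚᵘ (ℚᵘ.mkℚᵘ (ℤ.+ a) b)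

frac-≡⇒cross : ∀ a b c d → 1 ≤ b → 1 ≤ d → frac a b ≡ frac c d → a * d ≡ c * b
frac-≡⇒cross a (suc b) c (suc d) _ _ eq = ℚ.normalize-injective-≃ a c (suc b) (suc d) eq

frac-<⇒cross : ∀ a b c d → 1 ≤ b → 1 ≤ d → frac a b ℚ.< frac c d → a * d < c * b
frac-<⇒cross a (suc b) c (suc d) _ _ lt =
  ℤ.drop‿+<+ (subst₂ ℤ._<_ (sym (ℤ.pos-* a (suc d))) (sym (ℤ.pos-* c (suc b))) lt′)
  where
  lt′ : ℤ.+ a ℤ.* ℤ.+ suc d ℤ.< ℤ.+ c ℤ.* ℤ.+ suc b
  lt′ = ℚᵘ.drop-*<* (ℚᵘ.<-respˡ-≃ (frac≃ a b) (ℚᵘ.<-respʳ-≃ (frac≃ c d) (ℚ.toℚᵘ-mono-< lt)))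

frac-≤⇒cross : ∀ a b c d → 1 ≤ b → 1 ≤ d → frac a b ℚ.≤ frac c d → a * d ≤ c * b
frac-≤⇒cross a (suc b) c (suc d) _ _ le =
  ℤ.drop‿+≤+ (subst₂ ℤ._≤_ (sym (ℤ.pos-* a (suc d))) (sym (ℤ.pos-* c (suc b))) le′)
  where
  le′ : ℤ.+ a ℤ.* ℤ.+ suc d ℤ.≤ ℤ.+ c ℤ.* ℤ.+ suc b
  le′ = ℚᵘ.drop-*≤* (ℚᵘ.≤-respˡ-≃ (frac≃ a b) (ℚᵘ.≤-respʳ-≃ (frac≃ c d) (ℚ.toℚᵘ-mono-≤ le)))

ratio-≤-trans : ∀ {a a' b b' c c'} → 1 ≤ b' →
  a * b' ≤ b * a' → b * c' ≤ c * b' → a * c' ≤ c * a'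
ratio-≤-trans {a} {a'} {b} {b'} {c} {c'} b'≥1 ab bc =
  *-cancelʳ-≤ (a * c') (c * a') b' {{>-nonZero b'≥1}} (begin
    a * c' * b'   ≡⟨ swap a c' b' ⟩
    a * b' * c'   ≤⟨ *-monoˡ-≤ c' ab ⟩
    b * a' * c'   ≡⟨ swap b a' c' ⟩
    b * c' * a'   ≤⟨ *-monoˡ-≤ a' bc ⟩
    c * b' * a'   ≡⟨ swap c b' a' ⟩
    c * a' * b'   ∎)
  where
  open ≤-Reasoning
  swap : ∀ u v w → u * v * w ≡ u * w * v
  swap = solve-∀

-- The final squeeze: no ratio q = k/L satisfies q < r = a·b together with
-- b ≤ c and a·c = q, where r = R/R', a = A/A', b = B/B', c = C/C'.
ratio-squeeze : ∀ {k L R R' A A' B B' C C'} → 1 ≤ A' → 1 ≤ B' → 1 ≤ C' →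
  k * R' < R * L → R * (A' * B') ≡ (A * B) * R' →
  B * C' ≤ C * B' → (A * C) * L ≡ k * (A' * C') → ⊥
ratio-squeeze {k} {L} {R} {R'} {A} {A'} {B} {B'} {C} {C'} A'≥1 B'≥1 C'≥1 q<r r≡ab b≤c ac≡q =
  <-irrefl refl (begin-strict
    k * R' * D                 <⟨ *-monoˡ-< D {{>-nonZero D≥1}} q<r ⟩
    R * L * D                  ≡⟨ shuffle₁ R L A' B' C' ⟩
    R * (A' * B') * (L * C')   ≡⟨ cong (_* (L * C')) r≡ab ⟩
    A * B * R' * (L * C')      ≡⟨ shuffle₂ A B R' L C' ⟩
    B * C' * (A * R' * L)      ≤⟨ *-monoˡ-≤ (A * R' * L) b≤c ⟩
    C * B' * (A * R' * L)      ≡⟨ shuffle₃ C B' A R' L ⟩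
    A * C * L * (B' * R')      ≡⟨ cong (_* (B' * R')) ac≡q ⟩
    k * (A' * C') * (B' * R')  ≡⟨ shuffle₄ k A' C' B' R' ⟩
    k * R' * D                 ∎)
  where
  open ≤-Reasoning
  D = A' * B' * C'
  D≥1 : 1 ≤ D
  D≥1 = *-mono-≤ (*-mono-≤ A'≥1 B'≥1) C'≥1
  shuffle₁ : ∀ R L A' B' C' → R * L * (A' * B' * C') ≡ R * (A' * B') * (L * C')
  shuffle₁ = solve-∀
  shuffle₂ : ∀ A B R' L C' → A * B * R' * (L * C') ≡ B * C' * (A * R' * L)
  shuffle₂ = solve-∀
  shuffle₃ : ∀ C B' A R' L → C * B' * (A * R' * L) ≡ A * C * L * (B' * R')
  shuffle₃ = solve-∀
  shuffle₄ : ∀ k A' C' B' R' → k * (A' * C') * (B' * R') ≡ k * R' * (A' * B' * C')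
  shuffle₄ = solve-∀

^-distrib-* : ∀ a b x → (a * b) ^ x ≡ a ^ x * b ^ x
^-distrib-* a b zero    = refl
^-distrib-* a b (suc x) = begin
  a * b * (a * b) ^ x        ≡⟨ cong (a * b *_) (^-distrib-* a b x) ⟩
  a * b * (a ^ x * b ^ x)    ≡⟨ interchange a b (a ^ x) (b ^ x) ⟩
  a * a ^ x * (b * b ^ x)    ∎
  where
  open ≡-Reasoning
  interchange : ∀ a b c d → a * b * (c * d) ≡ a * c * (b * d)
  interchange = solve-∀

^-positive : ∀ {a} x → 1 ≤ a → 1 ≤ a ^ x
^-positive {suc a} x _ = m^n>0 (suc a) x

coprime-*ˡ : ∀ {a b c} → Coprime a c → Coprime b c → Coprime (a * b) c
coprime-*ˡ {a} a⊥c b⊥c (d∣ab , d∣c) = b⊥c (coprime-divisor d⊥a d∣ab , d∣c)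
  where
  d⊥a : Coprime _ a
  d⊥a (e∣d , e∣a) = a⊥c (e∣a , ∣-trans e∣d d∣c)

coprime-^ˡ : ∀ {a c} x → Coprime a c → Coprime (a ^ x) c
coprime-^ˡ {c = c} zero    a⊥c = 1-coprimeTo c
coprime-^ˡ         (suc x) a⊥c = coprime-*ˡ a⊥c (coprime-^ˡ x a⊥c)

prime∤⇒coprime : ∀ {p t} → Prime p → ¬ (p ∣ t) → Coprime p t
prime∤⇒coprime p-prime p∤t (d∣p , d∣t) with prime⇒irreducible p-prime d∣p
... | inj₁ d≡1    = d≡1
... | inj₂ refl   = ⊥-elim (p∤t d∣t)

prime>1 : ∀ {p} → Prime p → 1 < p
prime>1 {p} p-prime = nonTrivial⇒n>1 p {{prime⇒nonTrivial p-prime}}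

gcd-nonZero : ∀ d A → 1 ≤ A → NonZero (gcd d A)
gcd-nonZero d A A≥1 = ≢-nonZero λ g≡0 → <⇒≢ A≥1 (sym (gcd[m,n]≡0⇒n≡0 d g≡0))

-- x-th roots of divisibility: a^x ∣ b^x implies a ∣ b.  Dividing out
-- g = gcd a b leaves coprime a', b' with a' ∣ a'^x ∣ b'^x, forcing a' = 1.
^-∣-cancel : ∀ {a b} x → 1 ≤ x → 1 ≤ b → a ^ x ∣ b ^ x → a ∣ b
^-∣-cancel {a} {b} x@(suc x-1) _ b≥1 aˣ∣bˣ = subst (_∣ b) (sym a≡g) (gcd[m,n]∣n a b)
  where
  instance
    g≢0 : NonZero (gcd a b)
    g≢0 = gcd-nonZero a b b≥1
  g = gcd a b
  a' = a / g
  b' = b / g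
  gˣ≢0 : NonZero (g ^ x)
  gˣ≢0 = m^n≢0 g x
  a'ˣ∣b'ˣ : a' ^ x ∣ b' ^ x
  a'ˣ∣b'ˣ = *-cancelʳ-∣ (g ^ x) {{gˣ≢0}}
    (subst₂ _∣_ (trans (cong (_^ x) (sym (m/n*n≡m (gcd[m,n]∣m a b)))) (^-distrib-* a' g x))
                (trans (cong (_^ x) (sym (m/n*n≡m (gcd[m,n]∣n a b)))) (^-distrib-* b' g x)) aˣ∣bˣ)
  a'≡1 : a' ≡ 1
  a'≡1 = Coprime.sym (coprime-^ˡ x (Coprime.sym (coprime-/gcd a b)))
           (∣-refl , ∣-trans (m∣m*n (a' ^ x-1)) a'ˣ∣b'ˣ)
  a≡g : a ≡ g
  a≡g = begin
    a        ≡⟨ sym (m/n*n≡m (gcd[m,n]∣m a b)) ⟩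
    a' * g   ≡⟨ cong (_* g) a'≡1 ⟩
    1 * g    ≡⟨ *-identityˡ g ⟩
    g        ∎
    where open ≡-Reasoning

-- Every divisor of A·B is a product of a divisor of A and a divisor of B:
-- take gcd d A as the first factor.
divisor-split : ∀ {d A B} → 1 ≤ A → d ∣ A * B → ∃₂ λ a b → a ∣ A × b ∣ B × d ≡ a * b
divisor-split {d} {A} {B} A≥1 d∣AB = g , d' , gcd[m,n]∣n d A , d'∣B , d≡gd'
  where
  instance
    g≢0 : NonZero (gcd d A)
    g≢0 = gcd-nonZero d A A≥1
  g = gcd d A
  d' = d / g
  A' = A / g
  d≡gd' : d ≡ g * d'
  d≡gd' = trans (sym (m/n*n≡m (gcd[m,n]∣m d A))) (*-comm d' g)
  rearrange : ∀ a g b → a * g * b ≡ a * b * g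
  rearrange = solve-∀
  d'g∣A'Bg : d' * g ∣ A' * B * g
  d'g∣A'Bg = subst₂ _∣_ (sym (m/n*n≡m (gcd[m,n]∣m d A)))
    (trans (cong (_* B) (sym (m/n*n≡m (gcd[m,n]∣n d A)))) (rearrange A' g B)) d∣AB
  d'∣B : d' ∣ B
  d'∣B = coprime-divisor (coprime-/gcd d A) (*-cancelʳ-∣ g d'g∣A'Bg)

coprime-factor-unique : ∀ {A B a a' b b'} → Coprime A B → a ∣ A → a' ∣ A → b ∣ B → b' ∣ B →
                        a * b ≡ a' * b' → a ≡ a'
coprime-factor-unique {A} {B} {a} {a'} {b} {b'} A⊥B a∣A a'∣A b∣B b'∣B ab≡a'b' =
  ∣-antisym (cancel a∣A b'∣B (subst (a ∣_) (trans ab≡a'b' (*-comm a' b')) (m∣m*n b)))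
            (cancel a'∣A b∣B (subst (a' ∣_) (trans (sym ab≡a'b') (*-comm a b)) (m∣m*n b')))
  where
  cancel : ∀ {u v w} → u ∣ A → v ∣ B → u ∣ v * w → u ∣ w
  cancel u∣A v∣B = coprime-divisor λ (e∣u , e∣v) → A⊥B (∣-trans e∣u u∣A , ∣-trans e∣v v∣B)

positive-factorʳ : ∀ a {b} → 1 ≤ a * b → 1 ≤ b
positive-factorʳ a {b} ab≥1 = >-nonZero⁻¹ b {{m*n≢0⇒n≢0 a {{>-nonZero ab≥1}}}}

sum-set≡ : ∀ (f : ℕ → ℕ) {xs ys} → Unique xs → Unique ys →
           (∀ {y} → y ∈ xs → y ∈ ys) → (∀ {y} → y ∈ ys → y ∈ xs) →
           sum (map f xs) ≡ sum (map f ys)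
sum-set≡ f xs! ys! xs⊆ys ys⊆xs =
  sum-↭ (Perm.map⁺ f (∼bag⇒↭ (unique∧set⇒bag xs! ys! (mk⇔ xs⊆ys ys⊆xs))))

sum-⊆ : ∀ (f : ℕ → ℕ) {xs ys} → Unique xs → Unique ys →
        (∀ {y} → y ∈ xs → y ∈ ys) → sum (map f xs) ≤ sum (map f ys)
sum-⊆ f {xs} {ys} xs! ys! xs⊆ys = begin
  sum (map f xs)                          ≤⟨ m≤m+n _ _ ⟩
  sum (map f xs) + sum (map f rest)       ≡⟨ sym (sum-++ (map f xs) (map f rest)) ⟩
  sum (map f xs ++ map f rest)            ≡⟨ cong sum (sym (map-++ f xs rest)) ⟩
  sum (map f (xs ++ rest))                ≡⟨ sum-set≡ f xs++rest! ys! to from ⟩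
  sum (map f ys)                          ∎
  where
  open ≤-Reasoning
  outside? : (y : ℕ) → Dec (y ∉ xs)
  outside? y = ¬? (y ∈? xs)
  rest : List ℕ
  rest = filter outside? ys
  xs++rest! : Unique (xs ++ rest)
  xs++rest! = Unique.++⁺ xs! (Unique.filter⁺ outside? ys!)
                λ (y∈xs , y∈rest) → proj₂ (∈-filter⁻ outside? {xs = ys} y∈rest) y∈xs
  to : ∀ {y} → y ∈ xs ++ rest → y ∈ ys
  to y∈ with ∈-++⁻ xs y∈
  ... | inj₁ y∈xs   = xs⊆ys y∈xs
  ... | inj₂ y∈rest = proj₁ (∈-filter⁻ outside? {xs = ys} y∈rest)
  from : ∀ {y} → y ∈ ys → y ∈ xs ++ rest
  from {y} y∈ys with y ∈? xs
  ... | yes y∈xs = ∈-++⁺ˡ y∈xs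
  ... | no  y∉xs = ∈-++⁺ʳ xs (∈-filter⁺ outside? y∈ys y∉xs)

divisorsOf-unique : ∀ n → Unique (divisorsOf n)
divisorsOf-unique n = Unique.filter⁺ (_∣? n) (Unique.map⁺ suc-injective (Unique.upTo⁺ n))

∈-divisorsOf⁻ : ∀ {n d} → d ∈ divisorsOf n → d ∣ n
∈-divisorsOf⁻ {n} d∈ = proj₂ (∈-filter⁻ (_∣? n) {xs = map suc (upTo n)} d∈)

∈-divisorsOf⁺ : ∀ {n d} → 1 ≤ n → d ∣ n → d ∈ divisorsOf n
∈-divisorsOf⁺ {suc n} {zero}  _ 0∣n with () ← 0∣⇒≡0 0∣n
∈-divisorsOf⁺ {suc n} {suc d} _ d∣n =
  ∈-filter⁺ (_∣? suc n) (∈-map⁺ suc (∈-upTo⁺ (∣⇒≤ d∣n))) d∣n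

σ-as-sum : ∀ x {n ds} → 1 ≤ n → Unique ds →
           (∀ {d} → d ∈ ds → d ∣ n) → (∀ {d} → d ∣ n → d ∈ ds) →
           σ x n ≡ sum (map (_^ x) ds)
σ-as-sum x {n} n≥1 ds! ds⊆ ⊆ds = sum-set≡ (_^ x) (divisorsOf-unique n) ds!
  (λ d∈ → ⊆ds (∈-divisorsOf⁻ {n} d∈)) (λ d∈ → ∈-divisorsOf⁺ n≥1 (ds⊆ d∈))

sum-^-scale : ∀ x c ds → sum (map (_^ x) (map (c *_) ds)) ≡ c ^ x * sum (map (_^ x) ds)
sum-^-scale x c []       = sym (*-zeroʳ (c ^ x))
sum-^-scale x c (d ∷ ds) = trans (cong₂ _+_ (^-distrib-* c d x) (sum-^-scale x c ds))
                                 (sym (*-distribˡ-+ (c ^ x) (d ^ x) _))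

σ-positive : ∀ x n → 1 ≤ n → 1 ≤ σ x n
σ-positive x n n≥1 = subst (_≤ σ x n) (trans (+-identityʳ (1 ^ x)) (^-zeroˡ x))
  (sum-⊆ (_^ x) (All.[] ∷ []) (divisorsOf-unique n) λ { (here refl) → ∈-divisorsOf⁺ n≥1 (1∣ n) })

-- Monotonicity of the abundancy index along divisibility:
-- a ∣ b implies I(x,a) ≤ I(x,b), i.e. σ(a)·b^x ≤ σ(b)·a^x.
-- For b = c·a the multiples c·d of the divisors d of a are divisors of b.
σ-mono : ∀ x {a b} → 1 ≤ b → a ∣ b → σ x a * b ^ x ≤ σ x b * a ^ x
σ-mono x {a} {b} b≥1 (divides c b≡ca) = begin
  σ x a * b ^ x              ≡⟨ cong (λ z → σ x a * z ^ x) b≡ca ⟩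
  σ x a * (c * a) ^ x        ≡⟨ cong (σ x a *_) (^-distrib-* c a x) ⟩
  σ x a * (c ^ x * a ^ x)    ≡⟨ sym (*-assoc (σ x a) (c ^ x) (a ^ x)) ⟩
  σ x a * c ^ x * a ^ x      ≤⟨ *-monoˡ-≤ (a ^ x) cˣσa≤σb ⟩
  σ x b * a ^ x              ∎
  where
  open ≤-Reasoning
  c≢0 : NonZero c
  c≢0 = ≢-nonZero λ { refl → <⇒≢ b≥1 (sym b≡ca) }
  multiples : List ℕ
  multiples = map (c *_) (divisorsOf a)
  multiples! : Unique multiples
  multiples! = Unique.map⁺ (*-cancelˡ-≡ _ _ c {{c≢0}}) (divisorsOf-unique a)
  multiples⊆ : ∀ {y} → y ∈ multiples → y ∈ divisorsOf b
  multiples⊆ y∈ with ∈-map⁻ (c *_) y∈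
  ... | d , d∈ , refl = ∈-divisorsOf⁺ b≥1
    (subst (c * d ∣_) (sym b≡ca) (*-monoʳ-∣ c (∈-divisorsOf⁻ d∈)))
  cˣσa≤σb : σ x a * c ^ x ≤ σ x b
  cˣσa≤σb = subst (_≤ σ x b) (trans (sum-^-scale x c (divisorsOf a)) (*-comm (c ^ x) (σ x a)))
              (sum-⊆ (_^ x) multiples! (divisorsOf-unique b) multiples⊆)

sum-^-products : ∀ x ds es → sum (map (_^ x) (cartesianProductWith _*_ ds es))
                              ≡ sum (map (_^ x) ds) * sum (map (_^ x) es)
sum-^-products x []       es = refl
sum-^-products x (d ∷ ds) es = begin
  ∑ (map (d *_) es ++ rest)
    ≡⟨ cong sum (map-++ (_^ x) (map (d *_) es) rest) ⟩
  sum (map (_^ x) (map (d *_) es) ++ map (_^ x) rest)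
    ≡⟨ sum-++ (map (_^ x) (map (d *_) es)) _ ⟩
  ∑ (map (d *_) es) + ∑ rest
    ≡⟨ cong₂ _+_ (sum-^-scale x d es) (sum-^-products x ds es) ⟩
  d ^ x * ∑ es + ∑ ds * ∑ es
    ≡⟨ sym (*-distribʳ-+ (∑ es) (d ^ x) (∑ ds)) ⟩
  (d ^ x + ∑ ds) * ∑ es
    ∎
  where
  open ≡-Reasoning
  rest = cartesianProductWith _*_ ds es
  ∑ : List ℕ → ℕ
  ∑ xs = sum (map (_^ x) xs)

-- For coprime A and B, multiplying duplicate-free lists of divisors of A and
-- of B gives no repetitions (a·b determines a, by coprime-factor-unique).
products-unique : ∀ {A B ds es} → Coprime A B → 1 ≤ A → Unique ds → Unique es →
                  (∀ {d} → d ∈ ds → d ∣ A) → (∀ {e} → e ∈ es → e ∣ B) →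
                  Unique (cartesianProductWith _*_ ds es)
products-unique A⊥B A≥1 [] es! ds∣A es∣B = []
products-unique {ds = d ∷ ds} {es} A⊥B A≥1 (d∉ds ∷ ds!) es! ds∣A es∣B =
  Unique.++⁺ (Unique.map⁺ (*-cancelˡ-≡ _ _ d {{d≢0}}) es!)
             (products-unique A⊥B A≥1 ds! es! (ds∣A ∘ there) es∣B)
             disjoint
  where
  d≢0 : NonZero d
  d≢0 = ≢-nonZero λ { refl → <⇒≢ A≥1 (sym (0∣⇒≡0 (ds∣A (here refl)))) }
  disjoint : ∀ {v} → ¬ (v ∈ map (d *_) es × v ∈ cartesianProductWith _*_ ds es)
  disjoint (v∈dEs , v∈rest) with ∈-map⁻ (d *_) v∈dEs | ∈-cartesianProductWith⁻ _*_ ds es v∈rest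
  ... | e , e∈es , refl | d' , e' , d'∈ds , e'∈es , de≡d'e' =
    All.lookup d∉ds d'∈ds (coprime-factor-unique A⊥B (ds∣A (here refl)) (ds∣A (there d'∈ds))
                                               (es∣B e∈es) (es∣B e'∈es) de≡d'e')

-- σ_x is multiplicative: the divisors of A·B are exactly the products of a
-- divisor of A with a divisor of B.
σ-multiplicative : ∀ x {A B} → Coprime A B → 1 ≤ A → 1 ≤ B → σ x (A * B) ≡ σ x A * σ x B
σ-multiplicative x {A} {B} A⊥B A≥1 B≥1 =
  trans (σ-as-sum x (*-mono-≤ A≥1 B≥1) products! products∣AB ∣AB⇒product)
        (sum-^-products x (divisorsOf A) (divisorsOf B))
  where
  products : List ℕ
  products = cartesianProductWith _*_ (divisorsOf A) (divisorsOf B)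
  products! : Unique products
  products! = products-unique A⊥B A≥1 (divisorsOf-unique A) (divisorsOf-unique B)
                (∈-divisorsOf⁻ {A}) (∈-divisorsOf⁻ {B})
  products∣AB : ∀ {v} → v ∈ products → v ∣ A * B
  products∣AB v∈ with ∈-cartesianProductWith⁻ _*_ (divisorsOf A) (divisorsOf B) v∈
  ... | a , b , a∈ , b∈ , refl = *-pres-∣ (∈-divisorsOf⁻ {A} a∈) (∈-divisorsOf⁻ {B} b∈)
  ∣AB⇒product : ∀ {v} → v ∣ A * B → v ∈ products
  ∣AB⇒product v∣AB with divisor-split A≥1 v∣AB
  ... | a , b , a∣A , b∣B , refl =
    ∈-cartesianProductWith⁺ _*_ (∈-divisorsOf⁺ A≥1 a∣A) (∈-divisorsOf⁺ B≥1 b∣B)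

-- σ_x(p^(e+1)) = 1 + p^x·σ_x(p^e): a divisor of p^(e+1) is 1 when coprime
-- to p, and otherwise p times a divisor of p^e.
σ-prime-power : ∀ x {p} e → Prime p → σ x (p ^ suc e) ≡ 1 + p ^ x * σ x (p ^ e)
σ-prime-power x {p} e p-prime = begin
  σ x (p ^ suc e)                               ≡⟨ σ-as-sum x (^-positive (suc e) p≥1) ds! ds∣ ∣⇒ds ⟩
  1 ^ x + sum (map (_^ x) multiples)           ≡⟨ cong₂ _+_ (^-zeroˡ x) (sum-^-scale x p (divisorsOf (p ^ e))) ⟩
  1 + p ^ x * σ x (p ^ e)                       ∎
  where
  open ≡-Reasoning
  instance
    p≢0 : NonZero p
    p≢0 = >-nonZero (<-trans (s≤s z≤n) (prime>1 p-prime))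
  p≥1 : 1 ≤ p
  p≥1 = <⇒≤ (prime>1 p-prime)
  multiples : List ℕ
  multiples = map (p *_) (divisorsOf (p ^ e))
  ds : List ℕ
  ds = 1 ∷ multiples
  1∉multiples : All (1 ≢_) multiples
  1∉multiples = All.tabulate λ m∈ 1≡m → case m∈ 1≡m
    where
    case : ∀ {m} → m ∈ multiples → 1 ≡ m → ⊥
    case m∈ 1≡pq with ∈-map⁻ (p *_) m∈
    ... | q , _ , refl = <⇒≢ (prime>1 p-prime) (sym (m*n≡1⇒m≡1 p q (sym 1≡pq)))
  ds! : Unique ds
  ds! = 1∉multiples ∷ Unique.map⁺ (*-cancelˡ-≡ _ _ p) (divisorsOf-unique (p ^ e))
  ds∣ : ∀ {d} → d ∈ ds → d ∣ p ^ suc e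
  ds∣ (here refl) = 1∣ _
  ds∣ (there m∈) with ∈-map⁻ (p *_) m∈
  ... | q , q∈ , refl = *-monoʳ-∣ p (∈-divisorsOf⁻ {p ^ e} q∈)
  ∣⇒ds : ∀ {d} → d ∣ p ^ suc e → d ∈ ds
  ∣⇒ds {d} d∣pᵉ⁺¹ with p ∣? d
  ... | yes (divides q refl) = there (subst (_∈ multiples) (*-comm p q)
          (∈-map⁺ (p *_) (∈-divisorsOf⁺ (^-positive e p≥1)
            (*-cancelˡ-∣ p (subst (_∣ p ^ suc e) (*-comm q p) d∣pᵉ⁺¹)))))
  ... | no p∤d = subst (_∈ ds) (sym d≡1) (here refl)
    where
    d⊥pᵉ⁺¹ : Coprime d (p ^ suc e)
    d⊥pᵉ⁺¹ = Coprime.sym (coprime-^ˡ (suc e) (prime∤⇒coprime p-prime p∤d))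
    d≡1 : d ≡ 1
    d≡1 = d⊥pᵉ⁺¹ (∣-refl , d∣pᵉ⁺¹)

σ-prime-power∸1 : ∀ x {p} e → Prime p → σ x (p ^ suc e) ∸ 1 ≡ p ^ x * σ x (p ^ e)
σ-prime-power∸1 x e p-prime = cong (_∸ 1) (σ-prime-power x e p-prime)

σ-prime-power∸1-positive : ∀ x {p} e → Prime p → 1 ≤ σ x (p ^ suc e) ∸ 1
σ-prime-power∸1-positive x {p} e p-prime = subst (1 ≤_) (sym (σ-prime-power∸1 x e p-prime))
  (*-mono-≤ (^-positive x p≥1) (σ-positive x (p ^ e) (^-positive e p≥1)))
  where
  p≥1 : 1 ≤ p
  p≥1 = <⇒≤ (prime>1 p-prime)

distinct-primes-coprime : ∀ {p q} → Prime p → Prime q → p ≢ q → Coprime p q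
distinct-primes-coprime p-prime q-prime p≢q = prime∤⇒coprime p-prime λ p∣q →
  [ (λ p≡1 → <⇒≢ (prime>1 p-prime) (sym p≡1)) , p≢q ]′ (prime⇒irreducible q-prime p∣q)

∏-positive : ∀ s (f : Fin s → ℕ) → (∀ i → 1 ≤ f i) → 1 ≤ ∏ s f
∏-positive zero    f f≥1 = s≤s z≤n
∏-positive (suc s) f f≥1 = *-mono-≤ (f≥1 Fin.zero) (∏-positive s (f ∘ Fin.suc) (f≥1 ∘ Fin.suc))

∏-coprime : ∀ s (f : Fin s → ℕ) t → (∀ i → Coprime (f i) t) → Coprime (∏ s f) t
∏-coprime zero    f t f⊥t = 1-coprimeTo t
∏-coprime (suc s) f t f⊥t = coprime-*ˡ (f⊥t Fin.zero) (∏-coprime s (f ∘ Fin.suc) t (f⊥t ∘ Fin.suc))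

∏-split : ∀ s (p e : Fin s → ℕ) → (∀ i → Prime (p i)) → (∀ i j → p i ≡ p j → i ≡ j) →
          (j : Fin s) → Σ ℕ λ n' → ∏ s (λ i → p i ^ e i) ≡ p j ^ e j * n' × Coprime (p j) n'
∏-split (suc s) p e prime distinct Fin.zero =
  _ , refl , Coprime.sym (∏-coprime s _ (p Fin.zero) λ i →
    coprime-^ˡ (e (Fin.suc i)) (distinct-primes-coprime (prime (Fin.suc i)) (prime Fin.zero)
      λ pᵢ≡p₀ → Fin.0≢1+n (sym (distinct _ _ pᵢ≡p₀))))
∏-split (suc s) p e prime distinct (Fin.suc j)
  with ∏-split s (p ∘ Fin.suc) (e ∘ Fin.suc) (prime ∘ Fin.suc)
                 (λ i i' eq → Fin.suc-injective (distinct _ _ eq)) j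
... | n'' , rest≡ , pⱼ⊥n'' =
  p₀ᵉ * n'' , trans (cong (p₀ᵉ *_) rest≡) (swap p₀ᵉ (p (Fin.suc j) ^ e (Fin.suc j)) n'') ,
  Coprime.sym (coprime-*ˡ (coprime-^ˡ (e Fin.zero) p₀⊥pⱼ) (Coprime.sym pⱼ⊥n''))
  where
  p₀ᵉ = p Fin.zero ^ e Fin.zero
  swap : ∀ a b c → a * (b * c) ≡ b * (a * c)
  swap = solve-∀
  p₀⊥pⱼ : Coprime (p Fin.zero) (p (Fin.suc j))
  p₀⊥pⱼ = distinct-primes-coprime (prime Fin.zero) (prime (Fin.suc j))
            λ p₀≡pⱼ → Fin.0≢1+n (distinct _ _ p₀≡pⱼ)

-- Multiplying n = p^e·n' (p ∤ n') by p multiplies its abundancy by S/(S−1),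
-- where S = σ_x(p^(e+1)), so that S − 1 = p^x·σ_x(p^e):
-- I(p·n) = I(n)·S/(S−1), in cross-multiplied form.
abundancy-prime-factor : ∀ x {p} e {n n'} → Prime p → Coprime p n' → 1 ≤ n' → n ≡ p ^ e * n' →
  σ x (p * n) * (n ^ x * (σ x (p ^ suc e) ∸ 1)) ≡ σ x n * σ x (p ^ suc e) * (p * n) ^ x
abundancy-prime-factor x {p} e {n} {n'} p-prime p⊥n' n'≥1 n≡ = begin
  σ x (p * n) * (n ^ x * (S ∸ 1))        ≡⟨ cong₂ (λ u v → u * (n ^ x * v)) σ[pn] S∸1 ⟩
  S * σ x n' * (n ^ x * (p ^ x * s))      ≡⟨ shuffle S (σ x n') (n ^ x) (p ^ x) s ⟩
  s * σ x n' * S * (p ^ x * n ^ x)        ≡⟨ cong₂ (λ u v → u * S * v) (sym σ[n]) (sym pnˣ) ⟩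
  σ x n * S * (p * n) ^ x                 ∎
  where
  open ≡-Reasoning
  S = σ x (p ^ suc e)
  s = σ x (p ^ e)
  p≥1 : 1 ≤ p
  p≥1 = <⇒≤ (prime>1 p-prime)
  S∸1 : S ∸ 1 ≡ p ^ x * s
  S∸1 = σ-prime-power∸1 x e p-prime
  σ[n] : σ x n ≡ s * σ x n'
  σ[n] = trans (cong (σ x) n≡)
    (σ-multiplicative x (coprime-^ˡ e p⊥n') (^-positive e p≥1) n'≥1)
  σ[pn] : σ x (p * n) ≡ S * σ x n'
  σ[pn] = trans (cong (σ x) (trans (cong (p *_) n≡) (sym (*-assoc p (p ^ e) n'))))
    (σ-multiplicative x (coprime-^ˡ (suc e) p⊥n') (^-positive (suc e) p≥1) n'≥1)
  pnˣ : (p * n) ^ x ≡ p ^ x * n ^ x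
  pnˣ = ^-distrib-* p n x
  shuffle : ∀ S s' nˣ pˣ s → S * s' * (nˣ * (pˣ * s)) ≡ s * s' * S * (pˣ * nˣ)
  shuffle = solve-∀

divisor-abundancy-bound : ∀ x {N k L a} → 1 ≤ N → σ x N * L ≡ k * N ^ x → a ∣ N →
                          σ x a * L ≤ k * a ^ x
divisor-abundancy-bound x {N} {k} {L} {a} N≥1 σN≡ a∣N =
  ratio-≤-trans {σ x a} {a ^ x} {σ x N} {N ^ x} {k} {L}
    (^-positive x N≥1) (σ-mono x N≥1 a∣N) (≤-reflexive σN≡)

-- If I(x,N) = k/L with k, L coprime and n^x ∣ L, then n ∣ N:
-- L divides σ(N)·L = k·N^x, hence N^x.
abundancy-divisor : ∀ x {N k L n} → 1 ≤ x → 1 ≤ N → Coprime L k → n ^ x ∣ L →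
                    σ x N * L ≡ k * N ^ x → n ∣ N
abundancy-divisor x {N} {k} {L} x≥1 N≥1 L⊥k nˣ∣L σN≡ =
  ^-∣-cancel x x≥1 N≥1 (∣-trans nˣ∣L (coprime-divisor L⊥k (subst (L ∣_) σN≡ (n∣m*n (σ x N)))))

-- If I(x,N) = k/L and N = n·t, a prime p with k/L < I(x,p·n) cannot divide
-- t, as otherwise p·n would be a divisor of N of larger abundancy.
prime-∤-cofactor : ∀ x {N k L n t p} → 1 ≤ N → σ x N * L ≡ k * N ^ x → N ≡ n * t →
                   k * (p * n) ^ x < σ x (p * n) * L → ¬ (p ∣ t)
prime-∤-cofactor x {N} {k} {L} {n} {t} {p} N≥1 σN≡ N≡nt below (divides u t≡up) =
  <⇒≱ below (divisor-abundancy-bound x {N} {k} {L} {p * n} N≥1 σN≡ (divides u N≡u[pn]))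
  where
  N≡u[pn] : N ≡ u * (p * n)
  N≡u[pn] = trans N≡nt (trans (cong (n *_) t≡up) (rearrange n u p))
    where
    rearrange : ∀ n u p → n * (u * p) ≡ u * (p * n)
    rearrange = solve-∀

abundancy-product : ∀ x {N k L n t} → 1 ≤ n → 1 ≤ t → Coprime n t → N ≡ n * t →
                    σ x N * L ≡ k * N ^ x → σ x n * σ x t * L ≡ k * (n ^ x * t ^ x)
abundancy-product x {N} {k} {L} {n} {t} n≥1 t≥1 n⊥t N≡nt σN≡ = begin
  σ x n * σ x t * L   ≡⟨ cong (_* L) (sym (σ-multiplicative x n⊥t n≥1 t≥1)) ⟩
  σ x (n * t) * L     ≡⟨ cong (λ z → σ x z * L) (sym N≡nt) ⟩
  σ x N * L           ≡⟨ σN≡ ⟩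
  k * N ^ x           ≡⟨ cong (λ z → k * z ^ x) N≡nt ⟩
  k * (n * t) ^ x     ≡⟨ cong (k *_) (^-distrib-* n t x) ⟩
  k * (n ^ x * t ^ x) ∎
  where open ≡-Reasoning

abundancy-cofactor : ∀ x s (p e : Fin s → ℕ) {N k L} → (∀ i → Prime (p i)) → 1 ≤ x → 1 ≤ N →
  Coprime L k → ∏ s (λ i → p i ^ e i) ^ x ∣ L →
  (∀ i → k * (p i * ∏ s (λ i → p i ^ e i)) ^ x < σ x (p i * ∏ s (λ i → p i ^ e i)) * L) →
  σ x N * L ≡ k * N ^ x →
  Σ ℕ λ t → 1 ≤ t × N ≡ ∏ s (λ i → p i ^ e i) * t × Coprime (∏ s (λ i → p i ^ e i)) t
abundancy-cofactor x s p e {N} {k} {L} prime x≥1 N≥1 L⊥k nˣ∣L below σN≡ =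
  t , positive-factorʳ n (subst (1 ≤_) N≡nt N≥1) , N≡nt , n⊥t
  where
  n = ∏ s (λ i → p i ^ e i)
  n∣N : n ∣ N
  n∣N = abundancy-divisor x {N} {k} {L} x≥1 N≥1 L⊥k nˣ∣L σN≡
  t = quotient n∣N
  N≡nt : N ≡ n * t
  N≡nt = m∣n⇒n≡m*quotient n∣N
  n⊥t : Coprime n t
  n⊥t = ∏-coprime s (λ i → p i ^ e i) t λ i → coprime-^ˡ (e i)
    (prime∤⇒coprime (prime i) (prime-∤-cofactor x {N} {k} {L} {n} {t} {p i} N≥1 σN≡ N≡nt (below i)))

-- Hypothesis (2) forces d ∣ t: from I(x,n)·I(x,t) = k/L and L = Q·n^x we get
-- σ(n)·Q·σ(t) = k·t^x, and d^x divides σ(n)·Q while being coprime to k.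
divisor-of-cofactor : ∀ x {d k L Q n t A C} → 1 ≤ x → 1 ≤ n → 1 ≤ t → Coprime (d ^ x) k →
  d ^ x ∣ A * Q → L ≡ Q * n ^ x → A * C * L ≡ k * (n ^ x * t ^ x) → d ∣ t
divisor-of-cofactor x {d} {k} {L} {Q} {n} {t} {A} {C} x≥1 n≥1 t≥1 dˣ⊥k dˣ∣AQ L≡Qnˣ ACL≡ =
  ^-∣-cancel x x≥1 t≥1 (coprime-divisor dˣ⊥k (subst (d ^ x ∣_) AQC≡ktˣ (∣-trans dˣ∣AQ (m∣m*n C))))
  where
  AQC≡ktˣ : A * Q * C ≡ k * t ^ x
  AQC≡ktˣ = *-cancelʳ-≡ (A * Q * C) (k * t ^ x) (n ^ x) {{>-nonZero (^-positive x n≥1)}} (begin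
    A * Q * C * n ^ x       ≡⟨ shuffle₁ A Q C (n ^ x) ⟩
    A * C * (Q * n ^ x)     ≡⟨ cong (A * C *_) (sym L≡Qnˣ) ⟩
    A * C * L               ≡⟨ ACL≡ ⟩
    k * (n ^ x * t ^ x)     ≡⟨ shuffle₂ k (n ^ x) (t ^ x) ⟩
    k * t ^ x * n ^ x       ∎)
    where
    open ≡-Reasoning
    shuffle₁ : ∀ A Q C nˣ → A * Q * C * nˣ ≡ A * C * (Q * nˣ)
    shuffle₁ = solve-∀
    shuffle₂ : ∀ k nˣ tˣ → k * (nˣ * tˣ) ≡ k * tˣ * nˣ
    shuffle₂ = solve-∀

-- The closing squeeze.  Let p be a prime with n = p^e·n', p ∤ n', and
-- S = σ_x(p^(e+1)).  Then k/L < I(x,p·n) = I(x,n)·S/(S−1) and S/(S−1) ≤ I(x,t)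
-- are incompatible with I(x,n)·I(x,t) = k/L.
cofactor-contradiction : ∀ x {k L p} e {n t} → Prime p → 1 ≤ n → 1 ≤ t →
  (Σ ℕ λ n' → n ≡ p ^ e * n' × Coprime p n') →
  k * (p * n) ^ x < σ x (p * n) * L →
  σ x (p ^ suc e) * t ^ x ≤ σ x t * (σ x (p ^ suc e) ∸ 1) →
  σ x n * σ x t * L ≡ k * (n ^ x * t ^ x) → ⊥
cofactor-contradiction x {k} {L} {p} e {n} {t} p-prime n≥1 t≥1 (n' , n≡pᵉn' , p⊥n')
                       q<I[pn] S/S∸1≤I[t] I[n]I[t]≡q =
  ratio-squeeze {k} {L} {σ x (p * n)} {(p * n) ^ x} {σ x n} {n ^ x} {S} {S ∸ 1} {σ x t} {t ^ x}
    (^-positive x n≥1) (σ-prime-power∸1-positive x e p-prime) (^-positive x t≥1)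
    q<I[pn] (abundancy-prime-factor x e p-prime p⊥n' n'≥1 n≡pᵉn') S/S∸1≤I[t] I[n]I[t]≡q
  where
  S = σ x (p ^ suc e)
  n'≥1 : 1 ≤ n'
  n'≥1 = positive-factorʳ (p ^ e) (subst (1 ≤_) n≡pᵉn' n≥1)

mainTheorem3 : (x k l m : ℕ) → 1 ≤ x → 1 ≤ k → 1 ≤ l → 1 ≤ m
    → ℚ.1ℚ ℚ.< frac k (l * m ^ x)
    → gcd k (l * m ^ x) ≡ 1
    → (s : ℕ) (p e : Fin s → ℕ)
    → ((i : Fin s) → Prime (p i))
    → ((i j : Fin s) → p i ≡ p j → i ≡ j)
    → ((i : Fin s) → 1 ≤ e i)
    → (h : ∏ s (λ i → p i ^ e i) ^ x ∣ l * m ^ x)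
    → ((i : Fin s) → frac k (l * m ^ x) ℚ.< I x (p i * ∏ s (λ i → p i ^ e i)))
    → (Σ ℕ λ d → 1 ≤ d
    × (d ^ x ∣ σ x (∏ s (λ i → p i ^ e i)) * _∣_.quotient h)
    × gcd (d ^ x) k ≡ 1
    × ∃ λ (j : Fin s) →
    frac (σ x (p j ^ (1 + e j))) (σ x (p j ^ (1 + e j)) ∸ 1) ℚ.≤ I x d)
    → Outlaw x (frac k (l * m ^ x))
mainTheorem3 x k l m x≥1 _ l≥1 m≥1 q>1 gcd[k,L]≡1 s p e prime distinct _ nˣ∣L below
             (d , d≥1 , dˣ∣σ[n]Q , gcd[dˣ,k]≡1 , j , S/S∸1≤I[d]) = q>1 , not-abundancy
  where
  n = ∏ s (λ i → p i ^ e i)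
  L = l * m ^ x
  S = σ x (p j ^ suc (e j))
  Q = quotient nˣ∣L
  n≥1 : 1 ≤ n
  n≥1 = ∏-positive s (λ i → p i ^ e i) λ i → ^-positive (e i) (<⇒≤ (prime>1 (prime i)))
  L≥1 : 1 ≤ L
  L≥1 = *-mono-≤ l≥1 (^-positive x m≥1)
  below′ : ∀ i → k * (p i * n) ^ x < σ x (p i * n) * L
  below′ i = frac-<⇒cross k L (σ x (p i * n)) ((p i * n) ^ x) L≥1
               (^-positive x (*-mono-≤ (<⇒≤ (prime>1 (prime i))) n≥1)) (below i)
  S/S∸1≤σ[d]/dˣ : S * d ^ x ≤ σ x d * (S ∸ 1)
  S/S∸1≤σ[d]/dˣ = frac-≤⇒cross S (S ∸ 1) (σ x d) (d ^ x)
                    (σ-prime-power∸1-positive x (e j) (prime j)) (^-positive x d≥1) S/S∸1≤I[d]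
  σN≡ : ∀ {N} → 1 ≤ N → I x N ≡ frac k L → σ x N * L ≡ k * N ^ x
  σN≡ {N} N≥1 = frac-≡⇒cross (σ x N) (N ^ x) k L (^-positive x N≥1) L≥1
  not-abundancy : (N : ℕ) → 1 ≤ N → ¬ (I x N ≡ frac k L)
  not-abundancy N N≥1 I[N]≡q with abundancy-cofactor x s p e {N} {k} {L} prime x≥1 N≥1
      (Coprime.sym (gcd≡1⇒coprime gcd[k,L]≡1)) nˣ∣L below′ (σN≡ N≥1 I[N]≡q)
  ... | t , t≥1 , N≡nt , n⊥t =
    cofactor-contradiction x {k} {L} (e j) (prime j) n≥1 t≥1 (∏-split s p e prime distinct j)
      (below′ j) S/S∸1≤σ[t]/tˣ σ[n]σ[t]L≡
    where
    σ[n]σ[t]L≡ : σ x n * σ x t * L ≡ k * (n ^ x * t ^ x)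
    σ[n]σ[t]L≡ = abundancy-product x {N} {k} {L} n≥1 t≥1 n⊥t N≡nt (σN≡ N≥1 I[N]≡q)
    d∣t : d ∣ t
    d∣t = divisor-of-cofactor x {d} {k} {L} {Q} {A = σ x n} {σ x t} x≥1 n≥1 t≥1
            (gcd≡1⇒coprime gcd[dˣ,k]≡1) dˣ∣σ[n]Q (m∣n⇒n≡quotient*m nˣ∣L) σ[n]σ[t]L≡
    S/S∸1≤σ[t]/tˣ : S * t ^ x ≤ σ x t * (S ∸ 1)
    S/S∸1≤σ[t]/tˣ = ratio-≤-trans {S} {b = σ x d} {c = σ x t} (^-positive x d≥1)
                      S/S∸1≤σ[d]/dˣ (σ-mono x t≥1 d∣t)
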